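{- Let $g_n$ be the number of tilings of the honeycomb strip $H_n$ using monomers, slanted dimers and trimers (horizontal dimers not allowed), with $g_0=1$. Then for all $n\ge 0$, $g_n=T_{n+2}$, where $T_j$ are the tribonacci numbers.
   Context: The honeycomb strip $H_n$ consists of $n$ regular hexagons arranged in two rows, numbered $1,\dots,n$ from the bottom left so that odd-numbered hexagons form the bottom row and even-numbered ones the top row; hexagon $i$ shares an edge with hexagons $i\pm1$ and $i\pm2$. Here the allowed tiles are: monomers $\{i\}$, slanted dimers $\{i,i+1\}$, and trimers $\{i,i+1,i+2\}$ of three consecutively numbered hexagons; a tiling is a partition of the hexagons of $H_n$ into such tiles. Tribonacci numbers: $T_0=T_1=0$, $T_2=1$, $T_n=T_{n-1}+T_{n-2}+T_{n-3}$ for $n\ge3$. -}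

module Defs where

open import Data.Nat using (ℕ; zero; suc; _+_; _∸_; _≤ᵇ_; _<ᵇ_; _≡ᵇ_)
open import Data.Bool using (Bool; true; false; _∧_; if_then_else_)
open import Data.List using (List; []; _∷_; _++_; map; concatMap; filterᵇ; length; upTo)
open import Data.Product using (_×_; _,_)

T : ℕ → ℕ
T 0 = 0
T 1 = 0
T 2 = 1
T (suc (suc (suc n))) = T (suc (suc n)) + T (suc n) + T n

hexagons : ℕ → List ℕ
hexagons n = map suc (upTo n)

-- A tile is given by (first hexagon i, size k) and is the set {i, ..., i+k-1}.
-- Allowed tiles: monomers (k = 1), slanted dimers {i,i+1} (k = 2),
-- trimers {i,i+1,i+2} (k = 3).
Tile : Set
Tile = ℕ × ℕ

covers : Tile → ℕ → Bool
covers (i , k) h = (i ≤ᵇ h) ∧ (h <ᵇ i + k)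

tiles : ℕ → List Tile
tiles n = concatMap (λ i → concatMap (λ k → if i + k ∸ 1 ≤ᵇ n then (i , k) ∷ [] else [])
                                       (1 ∷ 2 ∷ 3 ∷ []))
                    (hexagons n)

sublists : {A : Set} → List A → List (List A)
sublists []       = [] ∷ []
sublists (x ∷ xs) = let r = sublists xs in r ++ map (x ∷_) r

coverCount : List Tile → ℕ → ℕ
coverCount ts h = length (filterᵇ (λ t → covers t h) ts)

allB : {A : Set} → (A → Bool) → List A → Bool
allB p []       = true
allB p (x ∷ xs) = p x ∧ allB p xs

isTiling : ℕ → List Tile → Bool
isTiling n ts = allB (λ h → coverCount ts h ≡ᵇ 1) (hexagons n)

tilings : ℕ → List (List Tile)
tilings n = filterᵇ (isTiling n) (sublists (tiles n))

g : ℕ → ℕ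
g n = length (tilings n)

-- Classify the tilings of H (n + 3) by the tile containing hexagon 1: it is one of the
-- three tiles {1}, {1,2}, {1,2,3}, and removing it leaves, up to renumbering, a tiling
-- of H (n + 2), H (n + 1) or H n.  Since tilings are counted among sublists of the list
-- of allowed tiles, the classification is carried out on sublists: those of x ∷ L split
-- into the sublists of L and x prepended to them, and after the first row of tiles the
-- allowed tiles of H (suc n) are those of H n shifted by one hexagon.
module Submission where

open import Defs
open import Data.Nat using (ℕ; _+_)
open import Relation.Binary.PropositionalEquality using (_≡_)

open import Data.Nat using (zero; suc; _∸_; _≤ᵇ_; _<ᵇ_; _≡ᵇ_)
open import Data.Nat.Properties using (+-comm; +-assoc; +-identityʳ)
open import Data.Bool using (Bool; true; false; _∧_; if_then_else_)
open import Data.Bool.Properties using (if-float)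
open import Data.List using (List; []; _∷_; _++_; map; concatMap; filterᵇ; length; upTo)
open import Data.Nat.ListAction using (sum)
open import Data.List.Properties
  using (length-++; filter-++; map-upTo; concatMap-cong; concatMap-map; map-concatMap)
open import Data.List.Relation.Unary.All using (All; []; _∷_; universal; universal-U)
open import Data.List.Relation.Unary.All.Properties using (++⁺; map⁺; applyUpTo⁺₂)
open import Data.List.Relation.Unary.AllPairs using (AllPairs; []; _∷_)
open import Data.Product using (_,_)
open import Function using (_∘_; id)
open import Relation.Nullary.Decidable using (T?)
open import Relation.Unary using (U)
open import Relation.Binary.PropositionalEquality using (refl; sym; trans; cong; cong₂; subst; module ≡-Reasoning)

open ≡-Reasoning

length-filterᵇ-map : ∀ {A B : Set} (p : B → Bool) (f : A → B) xs →
  length (filterᵇ p (map f xs)) ≡ length (filterᵇ (p ∘ f) xs)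
length-filterᵇ-map p f [] = refl
length-filterᵇ-map p f (x ∷ xs) with p (f x)
... | true  = cong suc (length-filterᵇ-map p f xs)
... | false = length-filterᵇ-map p f xs

module _ {A : Set} where

  countSublists : (List A → Bool) → List A → ℕ
  countSublists P L = length (filterᵇ P (sublists L))

  countSublists-[] : ∀ P P' → P [] ≡ P' [] → countSublists P [] ≡ countSublists P' []
  countSublists-[] P P' eq with P [] | P' [] | eq
  ... | true  | .true  | refl = refl
  ... | false | .false | refl = refl

  countSublists-∷ : ∀ P x L →
    countSublists P (x ∷ L) ≡ countSublists P L + countSublists (λ S → P (x ∷ S)) L
  countSublists-∷ P x L = begin
    length (filterᵇ P (subs ++ map (x ∷_) subs))
      ≡⟨ cong length (filter-++ (T? ∘ P) subs (map (x ∷_) subs)) ⟩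
    length (filterᵇ P subs ++ filterᵇ P (map (x ∷_) subs))
      ≡⟨ length-++ (filterᵇ P subs) ⟩
    countSublists P L + length (filterᵇ P (map (x ∷_) subs))
      ≡⟨ cong (countSublists P L +_) (length-filterᵇ-map P (x ∷_) subs) ⟩
    countSublists P L + countSublists (λ S → P (x ∷ S)) L ∎
    where subs = sublists L

  countSublists-cong : ∀ {Q : A → Set} {P P'} L → All Q L → (∀ S → All Q S → P S ≡ P' S) →
    countSublists P L ≡ countSublists P' L
  countSublists-cong {P = P} {P'} [] [] eq = countSublists-[] P P' (eq [] [])
  countSublists-cong {P = P} {P'} (x ∷ L) (qx ∷ qL) eq = begin
    countSublists P (x ∷ L)
      ≡⟨ countSublists-∷ P x L ⟩
    countSublists P L + countSublists (λ S → P (x ∷ S)) L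
      ≡⟨ cong₂ _+_ (countSublists-cong L qL eq)
                   (countSublists-cong L qL (λ S qS → eq (x ∷ S) (qx ∷ qS))) ⟩
    countSublists P' L + countSublists (λ S → P' (x ∷ S)) L
      ≡⟨ sym (countSublists-∷ P' x L) ⟩
    countSublists P' (x ∷ L) ∎

  countSublists-ext : ∀ {P P'} → (∀ S → P S ≡ P' S) → ∀ L → countSublists P L ≡ countSublists P' L
  countSublists-ext eq L = countSublists-cong {Q = U} L (universal-U L) (λ S _ → eq S)

  countSublists-none : ∀ {P} → (∀ S → P S ≡ false) → ∀ L → countSublists P L ≡ 0
  countSublists-none {P} never [] = countSublists-[] P (λ _ → false) (never [])
  countSublists-none {P} never (x ∷ L) =
    trans (countSublists-∷ P x L)
          (cong₂ _+_ (countSublists-none never L) (countSublists-none (never ∘ (x ∷_)) L))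

  countSublists-map : ∀ P (f : A → A) L →
    countSublists P (map f L) ≡ countSublists (λ S → P (map f S)) L
  countSublists-map P f [] = countSublists-[] P (λ S → P (map f S)) refl
  countSublists-map P f (x ∷ L) = begin
    countSublists P (f x ∷ map f L)
      ≡⟨ countSublists-∷ P (f x) (map f L) ⟩
    countSublists P (map f L) + countSublists (λ S → P (f x ∷ S)) (map f L)
      ≡⟨ cong₂ _+_ (countSublists-map P f L) (countSublists-map (λ S → P (f x ∷ S)) f L) ⟩
    countSublists (λ S → P (map f S)) L + countSublists (λ S → P (f x ∷ map f S)) L
      ≡⟨ sym (countSublists-∷ (λ S → P (map f S)) x L) ⟩
    countSublists (λ S → P (map f S)) (x ∷ L) ∎

  countSublists-++-unusable : ∀ P R L → All (λ r → ∀ S → P (r ∷ S) ≡ false) R →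
    countSublists P (R ++ L) ≡ countSublists P L
  countSublists-++-unusable P [] L [] = refl
  countSublists-++-unusable P (r ∷ R) L (never ∷ nevers) = begin
    countSublists P (r ∷ R ++ L)
      ≡⟨ countSublists-∷ P r (R ++ L) ⟩
    countSublists P (R ++ L) + countSublists (λ S → P (r ∷ S)) (R ++ L)
      ≡⟨ cong₂ _+_ (countSublists-++-unusable P R L nevers) (countSublists-none never (R ++ L)) ⟩
    countSublists P L + 0
      ≡⟨ +-identityʳ _ ⟩
    countSublists P L ∎

  countSublists-++-exclusive : ∀ P R L → AllPairs (λ r r' → ∀ S → P (r ∷ r' ∷ S) ≡ false) R →
    countSublists P (R ++ L) ≡
      countSublists P L + sum (map (λ r → countSublists (λ S → P (r ∷ S)) L) R)
  countSublists-++-exclusive P [] L [] = sym (+-identityʳ _)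
  countSublists-++-exclusive P (r ∷ R) L (excl ∷ excls) = begin
    countSublists P (r ∷ R ++ L)
      ≡⟨ countSublists-∷ P r (R ++ L) ⟩
    countSublists P (R ++ L) + countSublists Pr (R ++ L)
      ≡⟨ cong₂ _+_ (countSublists-++-exclusive P R L excls)
                   (countSublists-++-unusable Pr R L excl) ⟩
    (countSublists P L + rest) + countSublists Pr L
      ≡⟨ +-assoc (countSublists P L) rest _ ⟩
    countSublists P L + (rest + countSublists Pr L)
      ≡⟨ cong (countSublists P L +_) (+-comm rest _) ⟩
    countSublists P L + (countSublists Pr L + rest) ∎
    where
    Pr : List A → Bool
    Pr S = P (r ∷ S)
    rest : ℕ
    rest = sum (map (λ r' → countSublists (λ S → P (r' ∷ S)) L) R)

<ᵇ-suc : ∀ m n → (m <ᵇ suc n) ≡ (m ≤ᵇ n)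
<ᵇ-suc zero    n = refl
<ᵇ-suc (suc m) n = refl

≤ᵇ-suc : ∀ m n → (m ≤ᵇ suc n) ≡ (m ∸ 1 ≤ᵇ n)
≤ᵇ-suc zero    n = refl
≤ᵇ-suc (suc m) n = <ᵇ-suc m n

hexagons-suc : ∀ n → hexagons (suc n) ≡ 1 ∷ map suc (hexagons n)
hexagons-suc n = cong (λ hs → 1 ∷ map suc hs) (sym (map-upTo suc n))

upTo-suc : ∀ n → upTo (suc n) ≡ 0 ∷ hexagons n
upTo-suc n = cong (0 ∷_) (sym (map-upTo suc n))

shift : Tile → Tile
shift (i , k) = suc i , k

tileIfFits : ℕ → ℕ → ℕ → List Tile
tileIfFits n i k = if i + k ∸ 1 ≤ᵇ n then (i , k) ∷ [] else []

tilesStartingAt : ℕ → ℕ → List Tile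
tilesStartingAt n i = concatMap (tileIfFits n i) (1 ∷ 2 ∷ 3 ∷ [])

tileIfFits-suc : ∀ n i k → tileIfFits (suc n) (suc i) k ≡ map shift (tileIfFits n i k)
tileIfFits-suc n i k =
  trans (cong (λ b → if b then (suc i , k) ∷ [] else []) (≤ᵇ-suc (i + k) n))
        (sym (if-float (map shift) (i + k ∸ 1 ≤ᵇ n)))

tilesStartingAt-suc : ∀ n i → tilesStartingAt (suc n) (suc i) ≡ map shift (tilesStartingAt n i)
tilesStartingAt-suc n i = trans (concatMap-cong (tileIfFits-suc n i) (1 ∷ 2 ∷ 3 ∷ []))
                                (sym (map-concatMap shift (tileIfFits n i) (1 ∷ 2 ∷ 3 ∷ [])))

tiles-suc : ∀ n → tiles (suc n) ≡ tilesStartingAt (suc n) 1 ++ map shift (tiles n)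
tiles-suc n = begin
  concatMap row (hexagons (suc n))
    ≡⟨ cong (concatMap row) (hexagons-suc n) ⟩
  row 1 ++ concatMap row (map suc (hexagons n))
    ≡⟨ cong (row 1 ++_) (concatMap-map row suc (hexagons n)) ⟩
  row 1 ++ concatMap (row ∘ suc) (hexagons n)
    ≡⟨ cong (row 1 ++_) (concatMap-cong (tilesStartingAt-suc n) (hexagons n)) ⟩
  row 1 ++ concatMap (map shift ∘ tilesStartingAt n) (hexagons n)
    ≡⟨ cong (row 1 ++_) (sym (map-concatMap shift (tilesStartingAt n) (hexagons n))) ⟩
  row 1 ++ map shift (tiles n) ∎
  where row = tilesStartingAt (suc n)

firstRow-All : ∀ {P : Tile → Set} → P (1 , 1) → P (1 , 2) → P (1 , 3) → ∀ n → All P (tilesStartingAt n 1)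
firstRow-All p₁ p₂ p₃ zero                = []
firstRow-All p₁ p₂ p₃ (suc zero)          = p₁ ∷ []
firstRow-All p₁ p₂ p₃ (suc (suc zero))    = p₁ ∷ p₂ ∷ []
firstRow-All p₁ p₂ p₃ (suc (suc (suc n))) = p₁ ∷ p₂ ∷ p₃ ∷ []

Misses : ℕ → List Tile → Set
Misses h = All (λ t → covers t h ≡ false)

tiles-miss0 : ∀ n → Misses 0 (tiles n)
tiles-miss0 zero    = []
tiles-miss0 (suc n) = subst (Misses 0) (sym (tiles-suc n))
  (++⁺ (firstRow-All refl refl refl (suc n)) (map⁺ (universal (λ _ → refl) (tiles n))))

covers-shift : ∀ t h → covers (shift t) (suc h) ≡ covers t h
covers-shift (i , k) h = cong (_∧ (h <ᵇ i + k)) (<ᵇ-suc i h)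

coverCount-shift : ∀ S h → coverCount (map shift S) (suc h) ≡ coverCount S h
coverCount-shift []      h = refl
coverCount-shift (t ∷ S) h rewrite covers-shift t h with covers t h
... | true  = cong suc (coverCount-shift S h)
... | false = coverCount-shift S h

coverCount-missed : ∀ {h} S → Misses h S → coverCount S h ≡ 0
coverCount-missed []      []         = refl
coverCount-missed (t ∷ S) (miss ∷ ms) rewrite miss = coverCount-missed S ms

exactlyCovers : List ℕ → List Tile → Bool
exactlyCovers hs S = allB (λ h → coverCount S h ≡ᵇ 1) hs

exactlyCovers-shift : ∀ hs S → exactlyCovers (map suc hs) (map shift S) ≡ exactlyCovers hs S
exactlyCovers-shift []       S = refl
exactlyCovers-shift (h ∷ hs) S =
  cong₂ _∧_ (cong (_≡ᵇ 1) (coverCount-shift S h)) (exactlyCovers-shift hs S)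

exactlyCovers-∷-disjoint : ∀ {t} hs S → All (λ h → covers t h ≡ false) hs →
  exactlyCovers hs (t ∷ S) ≡ exactlyCovers hs S
exactlyCovers-∷-disjoint []       S []          = refl
exactlyCovers-∷-disjoint {t} (h ∷ hs) S (miss ∷ ms) rewrite miss =
  cong ((coverCount S h ≡ᵇ 1) ∧_) (exactlyCovers-∷-disjoint {t} hs S ms)

isTiling-suc-shift : ∀ n X → isTiling (suc n) (map shift X) ≡ exactlyCovers (0 ∷ hexagons n) X
isTiling-suc-shift n X =
  trans (exactlyCovers-shift (upTo (suc n)) X) (cong (λ hs → exactlyCovers hs X) (upTo-suc n))

isTiling-shift≡false : ∀ n S → Misses 0 S → isTiling (suc n) (map shift S) ≡ false
isTiling-shift≡false n S miss = trans (isTiling-suc-shift n S)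
  (cong (λ c → (c ≡ᵇ 1) ∧ exactlyCovers (hexagons n) S) (coverCount-missed S miss))

-- (1 , suc k) ∷ map shift S is the shift of (0 , suc k) ∷ S, in which only the first tile covers
-- hexagon 0; the tile (0 , k) then misses every hexagon ≥ k by computation, which discharges the
-- disjointness side conditions below.
isTiling-firstTile : ∀ n k S → Misses 0 S →
  isTiling (suc n) ((1 , suc k) ∷ map shift S) ≡ exactlyCovers (hexagons n) ((0 , suc k) ∷ S)
isTiling-firstTile n k S miss = trans (isTiling-suc-shift n ((0 , suc k) ∷ S))
  (cong (λ c → (suc c ≡ᵇ 1) ∧ exactlyCovers (hexagons n) ((0 , suc k) ∷ S)) (coverCount-missed S miss))

isTiling-monomerFirst : ∀ n S → Misses 0 S →
  isTiling (suc n) ((1 , 1) ∷ map shift S) ≡ isTiling n S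
isTiling-monomerFirst n S miss = trans (isTiling-firstTile n 0 S miss)
  (exactlyCovers-∷-disjoint {0 , 1} (hexagons n) S (map⁺ (applyUpTo⁺₂ id n (λ _ → refl))))

isTiling-dimerFirst : ∀ n S → Misses 0 S →
  isTiling (2 + n) ((1 , 2) ∷ map shift S) ≡
    (coverCount S 1 ≡ᵇ 0) ∧ exactlyCovers (map suc (hexagons n)) S
isTiling-dimerFirst n S miss = begin
  isTiling (2 + n) ((1 , 2) ∷ map shift S)
    ≡⟨ isTiling-firstTile (suc n) 1 S miss ⟩
  exactlyCovers (hexagons (suc n)) ((0 , 2) ∷ S)
    ≡⟨ cong (λ hs → exactlyCovers hs ((0 , 2) ∷ S)) (hexagons-suc n) ⟩
  (coverCount S 1 ≡ᵇ 0) ∧ exactlyCovers (map suc (hexagons n)) ((0 , 2) ∷ S)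
    ≡⟨ cong ((coverCount S 1 ≡ᵇ 0) ∧_) (exactlyCovers-∷-disjoint {0 , 2} (map suc (hexagons n)) S
              (map⁺ (map⁺ (applyUpTo⁺₂ id n (λ _ → refl))))) ⟩
  (coverCount S 1 ≡ᵇ 0) ∧ exactlyCovers (map suc (hexagons n)) S ∎

isTiling-trimerFirst : ∀ n S → Misses 0 S →
  isTiling (3 + n) ((1 , 3) ∷ map shift S) ≡
    (coverCount S 1 ≡ᵇ 0) ∧ ((coverCount S 2 ≡ᵇ 0) ∧ exactlyCovers (map suc (map suc (hexagons n))) S)
isTiling-trimerFirst n S miss = begin
  isTiling (3 + n) ((1 , 3) ∷ map shift S)
    ≡⟨ isTiling-firstTile (2 + n) 2 S miss ⟩
  exactlyCovers (hexagons (2 + n)) ((0 , 3) ∷ S)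
    ≡⟨ cong (λ hs → exactlyCovers hs ((0 , 3) ∷ S)) hexagons-2+ ⟩
  (coverCount S 1 ≡ᵇ 0) ∧ ((coverCount S 2 ≡ᵇ 0) ∧ exactlyCovers tail ((0 , 3) ∷ S))
    ≡⟨ cong (λ b → (coverCount S 1 ≡ᵇ 0) ∧ ((coverCount S 2 ≡ᵇ 0) ∧ b))
            (exactlyCovers-∷-disjoint {0 , 3} tail S (map⁺ (map⁺ (map⁺ (applyUpTo⁺₂ id n (λ _ → refl)))))) ⟩
  (coverCount S 1 ≡ᵇ 0) ∧ ((coverCount S 2 ≡ᵇ 0) ∧ exactlyCovers tail S) ∎
  where
  tail : List ℕ
  tail = map suc (map suc (hexagons n))
  hexagons-2+ : hexagons (2 + n) ≡ 1 ∷ 2 ∷ tail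
  hexagons-2+ = trans (hexagons-suc (suc n)) (cong (λ hs → 1 ∷ map suc hs) (hexagons-suc n))

countSublists-skipFirst : ∀ n (P : List Tile → Bool) →
  countSublists (λ S → (coverCount S 1 ≡ᵇ 0) ∧ P S) (tiles (suc n)) ≡
    countSublists (λ S → P (map shift S)) (tiles n)
countSublists-skipFirst n P = begin
  countSublists Q (tiles (suc n))
    ≡⟨ cong (countSublists Q) (tiles-suc n) ⟩
  countSublists Q (tilesStartingAt (suc n) 1 ++ map shift (tiles n))
    ≡⟨ countSublists-++-unusable Q _ _ (firstRow-All (λ _ → refl) (λ _ → refl) (λ _ → refl) (suc n)) ⟩
  countSublists Q (map shift (tiles n))
    ≡⟨ countSublists-map Q shift (tiles n) ⟩
  countSublists (λ S → Q (map shift S)) (tiles n)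
    ≡⟨ countSublists-cong (tiles n) (tiles-miss0 n) (λ S miss →
         cong (λ c → (c ≡ᵇ 0) ∧ P (map shift S)) (trans (coverCount-shift S 0) (coverCount-missed S miss))) ⟩
  countSublists (λ S → P (map shift S)) (tiles n) ∎
  where
  Q : List Tile → Bool
  Q S = (coverCount S 1 ≡ᵇ 0) ∧ P S

countSublists-exactlyCovers-shift : ∀ hs L →
  countSublists (λ S → exactlyCovers (map suc hs) (map shift S)) L ≡ countSublists (exactlyCovers hs) L
countSublists-exactlyCovers-shift hs = countSublists-ext (exactlyCovers-shift hs)

count-monomerFirst : ∀ n → countSublists (λ S → isTiling (suc n) ((1 , 1) ∷ map shift S)) (tiles n) ≡ g n
count-monomerFirst n = countSublists-cong (tiles n) (tiles-miss0 n) (isTiling-monomerFirst n)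

count-dimerFirst : ∀ n →
  countSublists (λ S → isTiling (2 + n) ((1 , 2) ∷ map shift S)) (tiles (suc n)) ≡ g n
count-dimerFirst n = begin
  countSublists (λ S → isTiling (2 + n) ((1 , 2) ∷ map shift S)) (tiles (suc n))
    ≡⟨ countSublists-cong (tiles (suc n)) (tiles-miss0 (suc n)) (isTiling-dimerFirst n) ⟩
  countSublists (λ S → (coverCount S 1 ≡ᵇ 0) ∧ exactlyCovers (map suc (hexagons n)) S) (tiles (suc n))
    ≡⟨ countSublists-skipFirst n (exactlyCovers (map suc (hexagons n))) ⟩
  countSublists (λ S → exactlyCovers (map suc (hexagons n)) (map shift S)) (tiles n)
    ≡⟨ countSublists-exactlyCovers-shift (hexagons n) (tiles n) ⟩
  g n ∎

count-trimerFirst : ∀ n →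
  countSublists (λ S → isTiling (3 + n) ((1 , 3) ∷ map shift S)) (tiles (2 + n)) ≡ g n
count-trimerFirst n = begin
  countSublists (λ S → isTiling (3 + n) ((1 , 3) ∷ map shift S)) (tiles (2 + n))
    ≡⟨ countSublists-cong (tiles (2 + n)) (tiles-miss0 (2 + n)) (isTiling-trimerFirst n) ⟩
  countSublists (λ S → (coverCount S 1 ≡ᵇ 0) ∧ P S) (tiles (2 + n))
    ≡⟨ countSublists-skipFirst (suc n) P ⟩
  countSublists (λ S → P (map shift S)) (tiles (suc n))
    ≡⟨ countSublists-ext (λ S → cong₂ _∧_ (cong (_≡ᵇ 0) (coverCount-shift S 1))
                                         (exactlyCovers-shift (map suc (hexagons n)) S)) (tiles (suc n)) ⟩
  countSublists (λ S → (coverCount S 1 ≡ᵇ 0) ∧ exactlyCovers (map suc (hexagons n)) S) (tiles (suc n))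
    ≡⟨ countSublists-skipFirst n (exactlyCovers (map suc (hexagons n))) ⟩
  countSublists (λ S → exactlyCovers (map suc (hexagons n)) (map shift S)) (tiles n)
    ≡⟨ countSublists-exactlyCovers-shift (hexagons n) (tiles n) ⟩
  g n ∎
  where
  P : List Tile → Bool
  P S = (coverCount S 2 ≡ᵇ 0) ∧ exactlyCovers (map suc (map suc (hexagons n))) S

firstRow : List Tile
firstRow = (1 , 1) ∷ (1 , 2) ∷ (1 , 3) ∷ []

-- Two tiles of the first row both cover hexagon 1.
firstRow-exclusive : ∀ n → AllPairs (λ r r' → ∀ S → isTiling (suc n) (r ∷ r' ∷ S) ≡ false) firstRow
firstRow-exclusive n = ((λ _ → refl) ∷ (λ _ → refl) ∷ []) ∷ ((λ _ → refl) ∷ []) ∷ [] ∷ []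

g-step : ∀ n → g (3 + n) ≡ g (2 + n) + g (1 + n) + g n
g-step n = begin
  countSublists (isTiling (3 + n)) (tiles (3 + n))
    ≡⟨ cong (countSublists (isTiling (3 + n))) (tiles-suc (2 + n)) ⟩
  countSublists (isTiling (3 + n)) (firstRow ++ map shift (tiles (2 + n)))
    ≡⟨ countSublists-++-exclusive (isTiling (3 + n)) firstRow (map shift (tiles (2 + n)))
         (firstRow-exclusive (2 + n)) ⟩
  countSublists (isTiling (3 + n)) (map shift (tiles (2 + n))) +
    (withFirst (1 , 1) + (withFirst (1 , 2) + (withFirst (1 , 3) + 0)))
    ≡⟨ cong₂ _+_ noFirstTile (cong₂ _+_ (shifted (1 , 1) (count-monomerFirst (2 + n)))
         (cong₂ _+_ (shifted (1 , 2) (count-dimerFirst (1 + n)))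
           (cong (_+ 0) (shifted (1 , 3) (count-trimerFirst n))))) ⟩
  0 + (g (2 + n) + (g (1 + n) + (g n + 0)))
    ≡⟨ cong (λ c → g (2 + n) + (g (1 + n) + c)) (+-identityʳ (g n)) ⟩
  g (2 + n) + (g (1 + n) + g n)
    ≡⟨ sym (+-assoc (g (2 + n)) (g (1 + n)) (g n)) ⟩
  g (2 + n) + g (1 + n) + g n ∎
  where
  withFirst : Tile → ℕ
  withFirst t = countSublists (λ S → isTiling (3 + n) (t ∷ S)) (map shift (tiles (2 + n)))
  shifted : ∀ t {c} → countSublists (λ S → isTiling (3 + n) (t ∷ map shift S)) (tiles (2 + n)) ≡ c →
    withFirst t ≡ c
  shifted t = trans (countSublists-map (λ S → isTiling (3 + n) (t ∷ S)) shift (tiles (2 + n)))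
  noFirstTile : countSublists (isTiling (3 + n)) (map shift (tiles (2 + n))) ≡ 0
  noFirstTile = trans (countSublists-map (isTiling (3 + n)) shift (tiles (2 + n)))
    (trans (countSublists-cong (tiles (2 + n)) (tiles-miss0 (2 + n)) (isTiling-shift≡false (2 + n)))
           (countSublists-none (λ _ → refl) (tiles (2 + n))))

g≡T : ∀ n → g n ≡ T (2 + n)
g≡T 0 = refl
g≡T 1 = refl
g≡T 2 = refl
g≡T (suc (suc (suc n))) = trans (g-step n)
  (cong₂ _+_ (cong₂ _+_ (g≡T (suc (suc n))) (g≡T (suc n))) (g≡T n))

theorem8 : (n : ℕ) → g n ≡ T (n + 2)
theorem8 n = trans (g≡T n) (cong T (+-comm 2 n))
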